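{- Let $\alpha\in\mathcal{C}_n$ and $i\in[n-1]$, and suppose $\alpha$ is both $(i,z_1)$-insertable and $(i,z_2)$-insertable, where $z_1,z_2\in[n-i-\alpha_i]$. Then: (i) $z_1=z_2$ if and only if $\widehat J(i,z_1)=\widehat J(i,z_2)$; (ii) $z_1>z_2$ if and only if $\widehat J(i,z_1)<\widehat J(i,z_2)$.
   Context: $[n]=\{1,\dots,n\}$. A (weak) composition is a finite sequence of nonnegative integers $(\alpha_1,\dots,\alpha_m)$ with $\alpha_k=0$ for $k>m$; $|\alpha|=\sum\alpha_k$. $\mathcal{C}_n$ is the set of compositions $(\alpha_1,\dots,\alpha_{n-1})$ with $0\leqslant\alpha_i\leqslant n-i$. For a composition $\alpha$, a positive integer $i$ and $j\in\mathbb{N}$: $c_{i,j}(\alpha)=0$ if $j\leqslant i+1$; for $j>i+1$, $c_{i,j}(\alpha)=c_{i,j-1}(\alpha)+1$ if $\alpha_{j-1}<\alpha_i-c_{i,j-1}(\alpha)$ and $c_{i,j}(\alpha)=c_{i,j-1}(\alpha)$ otherwise. For compositions with $|\alpha|=|\alpha'|+1$, $\alpha$ covers $\alpha'$ if there are positive integers $i<j$ with: (a1) $\alpha'_i\leqslant\alpha_i-1$; (a2) $\alpha'_j=\alpha_j+\alpha_i-\alpha'_i-1$; (a3) $\alpha'_k=\alpha_k$ for $k\neq i,j$; (a4) $c_{i,j}(\alpha)=c_{i,j}(\alpha')=\alpha'_i-\alpha_j$. For $\alpha\in\mathcal{C}_n$, $i\in[n-1]$, $z\in[n-i-\alpha_i]$: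 $\alpha$ is $(i,z)$-insertable if there exists $\alpha''\in\mathcal{C}_n$ with $\alpha''_i=\alpha_i+z$ such that $\alpha''$ covers $\alpha$. With $\widehat\alpha$ given by $\widehat\alpha_i=\alpha_i+z$, $\widehat\alpha_m=\alpha_m$ ($m\neq i$), set $\widehat J(i,z)=\max\{j>i:c_{i,j}(\alpha)=c_{i,j}(\widehat\alpha)\}$. -}

module Defs where

open import Data.Nat using (ℕ; zero; suc; _+_; _∸_; _≤_; _<_; _≤?_; _<?_; _≟_)
open import Data.List using (map; upTo)
open import Data.Nat.ListAction using (sum)
open import Data.Product using (_×_; ∃-syntax)
open import Data.Sum using (_⊎_)
open import Relation.Nullary using (yes; no)
open import Relation.Binary.PropositionalEquality using (_≡_; _≢_)

-- A (weak) composition is encoded as a function ℕ → ℕ, read 1-based: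
-- α k is the k-th part α_k (the value at index 0 is irrelevant / forced 0 in 𝒞ₙ).
Comp : Set
Comp = ℕ → ℕ

InC : ℕ → Comp → Set
InC n α =
  (∀ k → 1 ≤ k → k ≤ n ∸ 1 → α k ≤ n ∸ k) ×
  (∀ k → (k ≡ 0 ⊎ n ∸ 1 < k) → α k ≡ 0)

-- |α| for α supported in {1,…,n-1} (sum of α_0,…,α_{n-1}; α_0 = 0 in 𝒞ₙ).
weight : ℕ → Comp → ℕ
weight n α = sum (map α (upTo n))

-- c_{i,j}(α).  Since α_i - c_{i,j-1}(α) never goes negative (c only increases
-- while α_{j-1} < α_i - c, forcing α_i - c ≥ 1), truncated subtraction is exact.
c : ℕ → ℕ → Comp → ℕ
c i zero    α = 0
c i (suc j) α with suc j ≤? suc i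
... | yes _ = 0
... | no  _ with α j <? α i ∸ c i j α
...   | yes _ = suc (c i j α)
...   | no  _ = c i j α

-- α covers α' (both taken in 𝒞ₙ, so |·| is computed as weight n).
-- (a4) "c_{i,j}(α) = c_{i,j}(α') = α'_i - α_j" is written with the
-- subtraction moved across, which is exact over ℤ.
Covers : ℕ → Comp → Comp → Set
Covers n α α' =
  weight n α ≡ suc (weight n α') ×
  ∃[ i ] ∃[ j ] (1 ≤ i × i < j ×
         suc (α' i) ≤ α i ×
         α' j + 1 + α' i ≡ α j + α i ×
         (∀ k → k ≢ i → k ≢ j → α' k ≡ α k) ×
         c i j α ≡ c i j α' ×
         c i j α + α j ≡ α' i)

hat : Comp → ℕ → ℕ → Comp
hat α i z m with m ≟ i
... | yes _ = α i + z
... | no  _ = α m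

Insertable : ℕ → Comp → ℕ → ℕ → Set
Insertable n α i z =
  ∃[ α'' ] (InC n α'' × α'' i ≡ α i + z × Covers n α'' α)

IsJhat : Comp → ℕ → ℕ → ℕ → Set
IsJhat α i z J =
  i < J × c i J α ≡ c i J (hat α i z) ×
  (∀ j → i < j → c i j α ≡ c i j (hat α i z) → j ≤ J)

{-# OPTIONS --safe #-}
-- Compare the counts c_{i,j}(α) and c_{i,j}(α̂) as j grows: raising α_i by z
-- keeps c(α) ≤ c(α̂) ≤ c(α) + z, and once the two counts differ they differ
-- forever. So {j > i : c_{i,j}(α) = c_{i,j}(α̂)} is an interval ending at
-- Ĵ(i,z), which shrinks as z grows: Ĵ is antitone in z. An insertion at i is a
-- cover with source i, and its target must be the last agreement Ĵ(i,z);
-- conditions (a2) and (a4) then give α_Ĵ + 1 + c_{i,Ĵ}(α) = α_i + z, so Ĵ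
-- determines z. Antitone and injective together give both equivalences.
module Submission where

open import Defs
open import Data.Nat using (ℕ; zero; suc; _+_; _∸_; _≤_; _<_; _≤′_; ≤′-refl; ≤′-step; z≤n; s≤s; s≤s⁻¹; _≤?_; _<?_; _≟_)
open import Data.Nat.Properties
open import Data.Product using (_×_; _,_; proj₁; proj₂)
open import Function using (_∘_)
open import Function.Bundles using (_⇔_; mk⇔)
open import Relation.Nullary using (yes; no; contradiction)
open import Relation.Binary.PropositionalEquality
  using (_≡_; _≢_; refl; sym; trans; cong; subst; module ≡-Reasoning)
open import Data.Nat.Solver using (module +-*-Solver)
open +-*-Solver using (solve; _:+_; _:=_; con)

step : ℕ → ℕ → ℕ → ℕ
step a b x with b <? a ∸ x
... | yes _ = suc x
... | no  _ = x

step-incr : ∀ {a} b x → b + x < a → step a b x ≡ suc x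
step-incr {a} b x b+x<a with b <? a ∸ x
... | yes _   = refl
... | no  b≮ = contradiction (m+n≤o⇒m≤o∸n (suc b) b+x<a) b≮

step-stay : ∀ {a} b x → a ≤ b + x → step a b x ≡ x
step-stay {a} b x a≤b+x with b <? a ∸ x
... | yes b< = contradiction b< (≤⇒≯ (m≤n+o⇒m∸n≤o a x (≤-trans a≤b+x (≤-reflexive (+-comm b x)))))
... | no  _  = refl

-- Raising the pivot by z compensates for a count at most z higher, so the
-- raised count can never stay while the lower one moves.
raised-room : ∀ {a b x y z} → y ≤ x + z → b + x < a → b + y < a + z
raised-room {a} {b} {x} {y} {z} y≤x+z b+x<a = begin-strict
  b + y       ≤⟨ +-monoʳ-≤ b y≤x+z ⟩
  b + (x + z) ≡⟨ sym (+-assoc b x z) ⟩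
  b + x + z   <⟨ +-monoˡ-< z b+x<a ⟩
  a + z       ∎
  where open ≤-Reasoning

step-raised-bounds : ∀ {a b x y z} → x ≤ y → y ≤ x + z →
  step a b x ≤ step (a + z) b y × step (a + z) b y ≤ step a b x + z
step-raised-bounds {a} {b} {x} {y} {z} x≤y y≤x+z with b + x <? a | b + y <? a + z
... | yes lo | yes hi rewrite step-incr b x lo | step-incr b y hi = s≤s x≤y , s≤s y≤x+z
... | no  lo | no  hi rewrite step-stay b x (≮⇒≥ lo) | step-stay b y (≮⇒≥ hi) = x≤y , y≤x+z
... | yes lo | no  hi = contradiction (raised-room y≤x+z lo) hi
... | no  lo | yes hi rewrite step-stay b x (≮⇒≥ lo) | step-incr b y hi =
  m≤n⇒m≤1+n x≤y , +-cancelˡ-≤ b (suc y) (x + z) (begin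
    b + suc y   ≡⟨ +-suc b y ⟩
    suc (b + y) ≤⟨ hi ⟩
    a + z       ≤⟨ +-monoˡ-≤ z (≮⇒≥ lo) ⟩
    b + x + z   ≡⟨ +-assoc b x z ⟩
    b + (x + z) ∎)
  where open ≤-Reasoning

step-raised-strict : ∀ {a b x y z} → x < y → y ≤ x + z → step a b x < step (a + z) b y
step-raised-strict {a} {b} {x} {y} {z} x<y y≤x+z with b + x <? a | b + y <? a + z
... | yes lo | yes hi rewrite step-incr b x lo | step-incr b y hi = s≤s x<y
... | no  lo | no  hi rewrite step-stay b x (≮⇒≥ lo) | step-stay b y (≮⇒≥ hi) = x<y
... | yes lo | no  hi = contradiction (raised-room y≤x+z lo) hi
... | no  lo | yes hi rewrite step-stay b x (≮⇒≥ lo) | step-incr b y hi = m≤n⇒m≤1+n x<y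

c-base : ∀ {i j} β → j ≤ suc i → c i j β ≡ 0
c-base {j = zero}  β _ = refl
c-base {i} {suc j} β j≤i with suc j ≤? suc i
... | yes _   = refl
... | no  j≰i = contradiction j≤i j≰i

c-suc : ∀ {i j} β → i < j → c i (suc j) β ≡ step (β i) (β j) (c i j β)
c-suc {i} {j} β i<j with suc j ≤? suc i
... | yes j≤i = contradiction (s≤s⁻¹ j≤i) (<⇒≱ i<j)
... | no  _ with β j <? β i ∸ c i j β
...   | yes _ = refl
...   | no  _ = refl

c-cong : ∀ {i β γ} j → β i ≡ γ i → (∀ k → i < k → k < j → β k ≡ γ k) → c i j β ≡ c i j γ
c-cong zero _ _ = refl
c-cong {i} {β} {γ} (suc j) βi≡γi agree with j ≤? i
... | yes j≤i = trans (c-base β (s≤s j≤i)) (sym (c-base γ (s≤s j≤i)))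
... | no  j≰i
  rewrite c-suc β (≰⇒> j≰i) | c-suc γ (≰⇒> j≰i)
        | βi≡γi | agree j (≰⇒> j≰i) ≤-refl
        | c-cong j βi≡γi (λ k i<k k<j → agree k i<k (m≤n⇒m≤1+n k<j)) = refl

RaisedAt : ℕ → ℕ → Comp → Comp → Set
RaisedAt i z β γ = γ i ≡ β i + z × (∀ k → i < k → γ k ≡ β k)

module Raised {i z : ℕ} {β γ : Comp} (raised : RaisedAt i z β γ) where

  γi≡ : γ i ≡ β i + z
  γi≡ = proj₁ raised

  γk≡ : ∀ k → i < k → γ k ≡ β k
  γk≡ = proj₂ raised

  c-raised-bounds : ∀ j → c i j β ≤ c i j γ × c i j γ ≤ c i j β + z
  c-raised-bounds zero = z≤n , z≤n
  c-raised-bounds (suc j) with j ≤? i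
  ... | yes j≤i rewrite c-base β (s≤s j≤i) | c-base γ (s≤s j≤i) = z≤n , z≤n
  ... | no  j≰i rewrite c-suc β (≰⇒> j≰i) | c-suc γ (≰⇒> j≰i) | γi≡ | γk≡ j (≰⇒> j≰i) =
    step-raised-bounds (proj₁ (c-raised-bounds j)) (proj₂ (c-raised-bounds j))

  c-gap-step : ∀ {j} → i < j → c i j β < c i j γ → c i (suc j) β < c i (suc j) γ
  c-gap-step {j} i<j gap rewrite c-suc β i<j | c-suc γ i<j | γi≡ | γk≡ j i<j =
    step-raised-strict gap (proj₂ (c-raised-bounds j))

  c-gap-persists : ∀ {j k} → i < j → j ≤′ k → c i j β < c i j γ → c i k β < c i k γ
  c-gap-persists i<j ≤′-refl gap = gap
  c-gap-persists i<j (≤′-step j≤′k) gap =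
    c-gap-step (<-≤-trans i<j (≤′⇒≤ j≤′k)) (c-gap-persists i<j j≤′k gap)

  c-agree-downward : ∀ {j k} → i < j → j ≤ k → c i k β ≡ c i k γ → c i j β ≡ c i j γ
  c-agree-downward {j} i<j j≤k agreeₖ with c i j β ≟ c i j γ
  ... | yes agreeⱼ = agreeⱼ
  ... | no  differⱼ = contradiction agreeₖ (<⇒≢
        (c-gap-persists i<j (≤⇒≤′ j≤k) (≤∧≢⇒< (proj₁ (c-raised-bounds j)) differⱼ)))

hat-at : ∀ α i z → hat α i z i ≡ α i + z
hat-at α i z with i ≟ i
... | yes _  = refl
... | no i≢i = contradiction refl i≢i

hat-above : ∀ α i z k → i < k → hat α i z k ≡ α k
hat-above α i z k i<k with k ≟ i
... | yes k≡i = contradiction (sym k≡i) (<⇒≢ i<k)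
... | no  _   = refl

hat-raised : ∀ α i z → RaisedAt i z α (hat α i z)
hat-raised α i z = hat-at α i z , hat-above α i z

hat-raised-hat : ∀ α i {z₁ z₂} → z₂ ≤ z₁ → RaisedAt i (z₁ ∸ z₂) (hat α i z₂) (hat α i z₁)
hat-raised-hat α i {z₁} {z₂} z₂≤z₁ = raisedᵢ , λ k i<k →
  trans (hat-above α i z₁ k i<k) (sym (hat-above α i z₂ k i<k))
  where
    open ≡-Reasoning
    raisedᵢ : hat α i z₁ i ≡ hat α i z₂ i + (z₁ ∸ z₂)
    raisedᵢ = begin
      hat α i z₁ i          ≡⟨ hat-at α i z₁ ⟩
      α i + z₁              ≡⟨ cong (α i +_) (sym (m+[n∸m]≡n z₂≤z₁)) ⟩
      α i + (z₂ + (z₁ ∸ z₂)) ≡⟨ sym (+-assoc (α i) z₂ (z₁ ∸ z₂)) ⟩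
      α i + z₂ + (z₁ ∸ z₂)   ≡⟨ cong (_+ (z₁ ∸ z₂)) (sym (hat-at α i z₂)) ⟩
      hat α i z₂ i + (z₁ ∸ z₂) ∎

Jhat-antitone : ∀ {α i z₁ z₂ J₁ J₂} → z₂ ≤ z₁ → IsJhat α i z₁ J₁ → IsJhat α i z₂ J₂ → J₁ ≤ J₂
Jhat-antitone {α} {i} {z₁} {z₂} {J₁} z₂≤z₁ (i<J₁ , agree₁ , _) (_ , _ , maximal₂) =
  maximal₂ J₁ i<J₁ (≤-antisym lower (subst (c i J₁ (hat α i z₂) ≤_) (sym agree₁) upper))
  where
    lower : c i J₁ α ≤ c i J₁ (hat α i z₂)
    lower = proj₁ (Raised.c-raised-bounds (hat-raised α i z₂) J₁)
    upper : c i J₁ (hat α i z₂) ≤ c i J₁ (hat α i z₁)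
    upper = proj₁ (Raised.c-raised-bounds (hat-raised-hat α i z₂≤z₁) J₁)

Jhat-last-agreement : ∀ {α i z J j} → IsJhat α i z J → i < j →
  c i j α ≡ c i j (hat α i z) → c i (suc j) α ≢ c i (suc j) (hat α i z) → J ≡ j
Jhat-last-agreement {α} {i} {z} {J} {j} (_ , agreeJ , maximal) i<j agreeⱼ differ with J ≤? j
... | yes J≤j = ≤-antisym J≤j (maximal j i<j agreeⱼ)
... | no  J≰j = contradiction
      (Raised.c-agree-downward (hat-raised α i z) (m≤n⇒m≤1+n i<j) (≰⇒> J≰j) agreeJ) differ

-- A cover α'' ⋗ α adds mass to its source i' and removes it from j',
-- so an index where α'' exceeds α can only be the source.
cover-source : ∀ (α α'' : Comp) {i' j' k} →
  suc (α i') ≤ α'' i' → α j' + 1 + α i' ≡ α'' j' + α'' i' → (∀ m → m ≢ i' → m ≢ j' → α m ≡ α'' m) → α k < α'' k → k ≡ i'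
cover-source α α'' {i'} {j'} {k} rise moved rest rises with k ≟ i' | k ≟ j'
... | yes k≡i' | _ = k≡i'
... | no  k≢i' | no k≢j' = contradiction (rest k k≢i' k≢j') (<⇒≢ rises)
... | no  _    | yes refl = contradiction moved (<⇒≢ (begin-strict
  α k + 1 + α i'          ≡⟨ cong (_+ α i') (+-comm (α k) 1) ⟩
  suc (α k) + α i'        <⟨ +-monoʳ-< (suc (α k)) (n<1+n (α i')) ⟩
  suc (α k) + suc (α i')  ≤⟨ +-mono-≤ rises rise ⟩
  α'' k + α'' i'          ∎))
  where open ≤-Reasoning

cover-offset : ∀ {a b b'' s s'' C} → b + 1 + a ≡ b'' + s'' → s'' ≡ a + s → C + b'' ≡ a →
  b + 1 + C ≡ a + s
cover-offset {a} {b} {b''} {s} {s''} {C} moved raised used = +-cancelʳ-≡ a (b + 1 + C) (a + s) (begin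
  b + 1 + C + a      ≡⟨ solve 3 (λ b C a → b :+ con 1 :+ C :+ a := b :+ con 1 :+ a :+ C) refl b C a ⟩
  b + 1 + a + C      ≡⟨ cong (_+ C) (trans moved (cong (b'' +_) raised)) ⟩
  b'' + (a + s) + C  ≡⟨ solve 4 (λ b'' a s C → b'' :+ (a :+ s) :+ C := C :+ b'' :+ (a :+ s)) refl b'' a s C ⟩
  C + b'' + (a + s)  ≡⟨ cong (_+ (a + s)) used ⟩
  a + (a + s)        ≡⟨ +-comm a (a + s) ⟩
  a + s + a          ∎)
  where open ≡-Reasoning

-- Where the counts still agree, α_j + 1 + c = α_i + z says exactly that the
-- count keeps still under α but moves under α̂ at j, so j is the last agreement.
Jhat-from-offset : ∀ {α i z J j} → 1 ≤ z → IsJhat α i z J → i < j →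
  c i j α ≡ c i j (hat α i z) → α j + 1 + c i j α ≡ α i + z → J ≡ j
Jhat-from-offset {α} {i} {z} {J} {j} 1≤z Ĵ i<j agreeⱼ offset =
  Jhat-last-agreement Ĵ i<j agreeⱼ differ
  where
    α̂ : Comp
    α̂ = hat α i z
    C : ℕ
    C = c i j α
    stays : α i ≤ α j + C
    stays = +-cancelʳ-≤ 1 (α i) (α j + C) (begin
      α i + 1       ≤⟨ +-monoʳ-≤ (α i) 1≤z ⟩
      α i + z       ≡⟨ sym offset ⟩
      α j + 1 + C   ≡⟨ solve 2 (λ b C → b :+ con 1 :+ C := b :+ C :+ con 1) refl (α j) C ⟩
      α j + C + 1   ∎)
      where open ≤-Reasoning
    moves : α j + C < α i + z
    moves = subst (α j + C <_) offset
      (≤-reflexive (solve 2 (λ b C → con 1 :+ (b :+ C) := b :+ con 1 :+ C) refl (α j) C))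
    hat-step : step (α̂ i) (α̂ j) (c i j α̂) ≡ step (α i + z) (α j) C
    hat-step rewrite hat-at α i z | hat-above α i z j i<j | sym agreeⱼ = refl
    differ : c i (suc j) α ≢ c i (suc j) α̂
    differ eq = 1+n≢n (sym (begin
      C                          ≡⟨ sym (step-stay (α j) C stays) ⟩
      step (α i) (α j) C         ≡⟨ sym (c-suc α i<j) ⟩
      c i (suc j) α              ≡⟨ eq ⟩
      c i (suc j) α̂              ≡⟨ c-suc α̂ i<j ⟩
      step (α̂ i) (α̂ j) (c i j α̂) ≡⟨ hat-step ⟩
      step (α i + z) (α j) C     ≡⟨ step-incr (α j) C moves ⟩
      suc C                      ∎))
      where open ≡-Reasoning

insertion-offset : ∀ {n α i z J} → 1 ≤ z → Insertable n α i z → IsJhat α i z J →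
  α J + 1 + c i J α ≡ α i + z
insertion-offset {α = α} {i} {z} {J} 1≤z
  (α'' , _ , α''ᵢ , _ , i' , j , _ , i'<j , rise , moved , rest , c≡ , used) Ĵ
  with refl ← cover-source α α'' {k = i} rise moved rest
                 (subst (α i <_) (sym α''ᵢ) (m<m+n (α i) 1≤z)) =
  subst (λ J → α J + 1 + c i J α ≡ α i + z) (sym (Jhat-from-offset 1≤z Ĵ i'<j agreeⱼ offset)) offset
  where
    offset : α j + 1 + c i j α ≡ α i + z
    offset = cover-offset moved α''ᵢ (trans (cong (_+ α'' j) (sym c≡)) used)
    agreeⱼ : c i j α ≡ c i j (hat α i z)
    agreeⱼ = trans (sym c≡) (c-cong j (trans α''ᵢ (sym (hat-at α i z))) λ k i<k k<j →
      trans (sym (rest k (<⇒≢ i<k ∘ sym) (<⇒≢ k<j))) (sym (hat-above α i z k i<k)))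

Jhat-injective : ∀ {n α i z₁ z₂ J} → 1 ≤ z₁ → 1 ≤ z₂ →
  Insertable n α i z₁ → Insertable n α i z₂ → IsJhat α i z₁ J → IsJhat α i z₂ J → z₁ ≡ z₂
Jhat-injective {α = α} {i} 1≤z₁ 1≤z₂ ins₁ ins₂ Ĵ₁ Ĵ₂ = +-cancelˡ-≡ (α i) _ _
  (trans (sym (insertion-offset 1≤z₁ ins₁ Ĵ₁)) (insertion-offset 1≤z₂ ins₂ Ĵ₂))

proposition3p13 : (n : ℕ) (α : Comp) (i z₁ z₂ : ℕ) →
    InC n α → 1 ≤ i → i ≤ n ∸ 1 →
    1 ≤ z₁ → z₁ ≤ n ∸ i ∸ α i → 1 ≤ z₂ → z₂ ≤ n ∸ i ∸ α i →
    Insertable n α i z₁ → Insertable n α i z₂ →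
    (J₁ J₂ : ℕ) → IsJhat α i z₁ J₁ → IsJhat α i z₂ J₂ →
    ((z₁ ≡ z₂) ⇔ (J₁ ≡ J₂)) × ((z₂ < z₁) ⇔ (J₁ < J₂))
proposition3p13 n α i z₁ z₂ _ _ _ 1≤z₁ _ 1≤z₂ _ ins₁ ins₂ J₁ J₂ Ĵ₁ Ĵ₂ =
  mk⇔ same-z⇒same-J same-J⇒same-z , mk⇔ larger-z⇒smaller-J smaller-J⇒larger-z
  where
    same-J⇒same-z : J₁ ≡ J₂ → z₁ ≡ z₂
    same-J⇒same-z refl = Jhat-injective 1≤z₁ 1≤z₂ ins₁ ins₂ Ĵ₁ Ĵ₂

    same-z⇒same-J : z₁ ≡ z₂ → J₁ ≡ J₂
    same-z⇒same-J refl = ≤-antisym (Jhat-antitone ≤-refl Ĵ₁ Ĵ₂) (Jhat-antitone ≤-refl Ĵ₂ Ĵ₁)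

    larger-z⇒smaller-J : z₂ < z₁ → J₁ < J₂
    larger-z⇒smaller-J z₂<z₁ = ≤∧≢⇒< (Jhat-antitone (<⇒≤ z₂<z₁) Ĵ₁ Ĵ₂)
      (λ J₁≡J₂ → <⇒≢ z₂<z₁ (sym (same-J⇒same-z J₁≡J₂)))

    smaller-J⇒larger-z : J₁ < J₂ → z₂ < z₁
    smaller-J⇒larger-z J₁<J₂ = ≰⇒> (λ z₁≤z₂ → <⇒≱ J₁<J₂ (Jhat-antitone z₁≤z₂ Ĵ₂ Ĵ₁))
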